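{- There are infinitely many $c\in\mathbb{Q}$ such that, for $f_c(x)=x^2+c$, there exists $x_0\in\mathbb{Q}$ for which $x_0$, $f_c(x_0)$, $f_c^2(x_0)$ are three distinct squares of rational numbers.
   Context: $f_c^2=f_c\circ f_c$. -}

module Defs where

open import Data.Rational using (ℚ; _+_; _*_)
open import Data.Product using (∃; _×_)
open import Relation.Binary.PropositionalEquality using (_≡_; _≢_)

f : ℚ → ℚ → ℚ
f c x = x * x + c

IsSquare : ℚ → Set
IsSquare q = ∃ λ r → q ≡ r * r

Good : ℚ → Set
Good c = ∃ λ x₀ →
  IsSquare x₀ × IsSquare (f c x₀) × IsSquare (f c (f c x₀)) ×
  x₀ ≢ f c x₀ × x₀ ≢ f c (f c x₀) × f c x₀ ≢ f c (f c x₀)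

{-# OPTIONS --safe #-}
-- Start the orbit at x₀ = 0: it runs 0, c, c² + c = c (c + 1), so x₀ works as soon as c > 0 and
-- both c and c + 1 are rational squares, and then 0 < c < c² + c makes the three values distinct.
-- Such c are unbounded: for u ≥ 1 and w = 1/(4u) we get (u + w)² = (u − w)² + 1, so c = (u − w)²
-- works, and since w ≤ 1 it satisfies c ≥ u − w ≥ u − 1, which exceeds any given bound.
module Submission where

open import Defs
open import Data.Rational using (ℚ)
open import Data.List using (List)
open import Data.List.Membership.Propositional using (_∉_)
open import Data.Product using (∃; _×_)

open import Data.Product using (_,_; proj₁; proj₂)
open import Data.Rational using (0ℚ; 1ℚ; _+_; _*_; _-_; _≤_; _<_; 1/_; Positive; positive; nonNegative)
open import Data.Rational.Properties
open import Data.Rational.Solver using (module +-*-Solver)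
open import Data.List.Relation.Unary.All using (lookup)
open import Relation.Binary.Bundles using (DecTotalOrder)
import Data.List.Extrema (DecTotalOrder.totalOrder ≤-decTotalOrder) as Extrema
open import Relation.Binary.PropositionalEquality
  using (_≡_; refl; sym; trans; cong; cong₂; subst; subst₂; module ≡-Reasoning)

open +-*-Solver using (solve; _:=_; _:+_; _:*_; _:-_; con)

0<1 : 0ℚ < 1ℚ
0<1 = positive⁻¹ 1ℚ

p<p*p+p : ∀ {p} → 0ℚ < p → p < p * p + p
p<p*p+p {p} 0<p = subst (_< p * p + p) (+-identityˡ p) (+-monoˡ-< p 0<p*p)
  where
  instance _ = positive 0<p
  0<p*p : 0ℚ < p * p
  0<p*p = positive⁻¹ (p * p) {{pos*pos⇒pos p p}}

p≤p*p : ∀ {p} → 1ℚ ≤ p → p ≤ p * p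
p≤p*p {p} 1≤p = subst (_≤ p * p) (*-identityʳ p) (*-monoˡ-≤-nonNeg p 1≤p)
  where instance _ = nonNegative (≤-trans (<⇒≤ 0<1) 1≤p)

1/p≤1 : ∀ p .{{_ : Positive p}} → 1ℚ ≤ p → (1/ p) {{pos⇒nonZero p}} ≤ 1ℚ
1/p≤1 p 1≤p = subst₂ _≤_ (*-identityʳ p⁻¹) (*-inverseˡ p) (*-monoˡ-≤-nonNeg p⁻¹ 1≤p)
  where
  instance _ = pos⇒nonZero p
  p⁻¹ = 1/ p
  instance _ = pos⇒nonNeg p⁻¹ {{1/pos⇒pos p}}

[u+w]²≡[u-w]²+4uw : ∀ u w → (u + w) * (u + w) ≡ (u - w) * (u - w) + (u + u + u + u) * w
[u+w]²≡[u-w]²+4uw = solve 2 (λ u w →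
  (u :+ w) :* (u :+ w) := (u :- w) :* (u :- w) :+ (u :+ u :+ u :+ u) :* w) refl

IsSquare-* : ∀ {p q} → IsSquare p → IsSquare q → IsSquare (p * q)
IsSquare-* {p} {q} (r , p≡r²) (s , q≡s²) = r * s , (begin
  p * q             ≡⟨ cong₂ _*_ p≡r² q≡s² ⟩
  (r * r) * (s * s) ≡⟨ solve 2 (λ r s → (r :* r) :* (s :* s) := (r :* s) :* (r :* s)) refl r s ⟩
  (r * s) * (r * s) ∎)
  where open ≡-Reasoning

f[c,0]≡c : ∀ c → f c 0ℚ ≡ c
f[c,0]≡c = solve 1 (λ c → con 0ℚ :* con 0ℚ :+ c := c) refl

f[c,c]≡c*[c+1] : ∀ c → f c c ≡ c * (c + 1ℚ)
f[c,c]≡c*[c+1] = solve 1 (λ c → c :* c :+ c := c :* (c :+ con 1ℚ)) refl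

good-of-increasing-square-orbit : ∀ {c x₀} →
  IsSquare x₀ → IsSquare (f c x₀) → IsSquare (f c (f c x₀)) →
  x₀ < f c x₀ → f c x₀ < f c (f c x₀) → Good c
good-of-increasing-square-orbit {x₀ = x₀} □x₀ □x₁ □x₂ x₀<x₁ x₁<x₂ =
  x₀ , □x₀ , □x₁ , □x₂ , <⇒≢ x₀<x₁ , <⇒≢ (<-trans x₀<x₁ x₁<x₂) , <⇒≢ x₁<x₂

SquareWithSquareSuccessor : ℚ → Set
SquareWithSquareSuccessor c = IsSquare c × IsSquare (c + 1ℚ)

good-if-square-with-square-successor : ∀ {c} → 0ℚ < c → SquareWithSquareSuccessor c → Good c
good-if-square-with-square-successor {c} 0<c (□c , □c+1) =
  good-of-increasing-square-orbit {x₀ = 0ℚ} (0ℚ , refl) □x₁ □x₂ 0<x₁ x₁<x₂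
  where
  x₁≡c : f c 0ℚ ≡ c
  x₁≡c = f[c,0]≡c c
  x₂≡c*[c+1] : f c (f c 0ℚ) ≡ c * (c + 1ℚ)
  x₂≡c*[c+1] = trans (cong (f c) x₁≡c) (f[c,c]≡c*[c+1] c)
  □x₁ : IsSquare (f c 0ℚ)
  □x₁ = subst IsSquare (sym x₁≡c) □c
  □x₂ : IsSquare (f c (f c 0ℚ))
  □x₂ = subst IsSquare (sym x₂≡c*[c+1]) (IsSquare-* □c □c+1)
  0<x₁ : 0ℚ < f c 0ℚ
  0<x₁ = subst (0ℚ <_) (sym x₁≡c) 0<c
  x₁<x₂ : f c 0ℚ < f c (f c 0ℚ)
  x₁<x₂ = subst₂ _<_ (sym x₁≡c) (cong (f c) (sym x₁≡c)) (p<p*p+p 0<c)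

square-with-square-successor-above : ∀ B → 0ℚ ≤ B → ∃ λ c → B < c × SquareWithSquareSuccessor c
square-with-square-successor-above B 0≤B = r * r , B<r*r , (r , refl) , (s , sym s²≡r²+1)
  where
  u = B + 1ℚ + 1ℚ
  D = u + u + u + u
  1≤u : 1ℚ ≤ u
  1≤u = +-mono-≤ (+-mono-≤ 0≤B (<⇒≤ 0<1)) (≤-refl {1ℚ})
  1≤D : 1ℚ ≤ D
  1≤D = +-mono-≤ (+-mono-≤ (+-mono-≤ 1≤u 0≤u) 0≤u) 0≤u
    where 0≤u = ≤-trans (<⇒≤ 0<1) 1≤u
  instance
    D-pos : Positive D
    D-pos = positive (<-≤-trans 0<1 1≤D)
    D-nonZero = pos⇒nonZero D
  w = 1/ D
  r = u - w
  s = u + w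
  s²≡r²+1 : s * s ≡ r * r + 1ℚ
  s²≡r²+1 = trans ([u+w]²≡[u-w]²+4uw u w) (cong (r * r +_) (*-inverseʳ D))
  u-1≡B+1 : u - 1ℚ ≡ B + 1ℚ
  u-1≡B+1 = solve 1 (λ B → B :+ con 1ℚ :+ con 1ℚ :- con 1ℚ := B :+ con 1ℚ) refl B
  B+1≤r : B + 1ℚ ≤ r
  B+1≤r = subst (_≤ r) u-1≡B+1 (+-monoʳ-≤ u (neg-antimono-≤ (1/p≤1 D 1≤D)))
  B<B+1 : B < B + 1ℚ
  B<B+1 = subst (_< B + 1ℚ) (+-identityʳ B) (+-monoʳ-< B 0<1)
  1≤r : 1ℚ ≤ r
  1≤r = ≤-trans (+-monoˡ-≤ 1ℚ 0≤B) B+1≤r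
  B<r*r : B < r * r
  B<r*r = <-≤-trans (<-≤-trans B<B+1 B+1≤r) (p≤p*p 1≤r)

mainTheorem3 : (L : List ℚ) → ∃ λ c → c ∉ L × Good c
mainTheorem3 L = c , c∉L , good-if-square-with-square-successor 0<c □c
  where
  B = Extrema.max 0ℚ L
  0≤B : 0ℚ ≤ B
  0≤B = Extrema.⊥≤max 0ℚ L
  above = square-with-square-successor-above B 0≤B
  c = proj₁ above
  B<c : B < c
  B<c = proj₁ (proj₂ above)
  □c : SquareWithSquareSuccessor c
  □c = proj₂ (proj₂ above)
  c∉L : c ∉ L
  c∉L c∈L = <-irrefl refl (<-≤-trans B<c (lookup (Extrema.xs≤max 0ℚ L) c∈L))
  0<c : 0ℚ < c
  0<c = ≤-<-trans 0≤B B<c
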